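{- Let $X$ be a finite set, $\mathcal{C}$ a set of partial characters on $X$, $H$ a minimal triangulation of $\operatorname{int}(\mathcal{C})$, $(T,\mathcal{K})$ a clique tree of $H$, and suppose $(T,\mathcal{K})$ induces the $X$-tree $\mathcal{T}$. Then the underlying tree of $\mathcal{T}$ is $T$.
   Context: A partial character on $X$ is a partition $\chi$ of a subset of $X$ into nonempty cells. The partition intersection graph $\operatorname{int}(\mathcal{C})$ has vertex set $\{(A,\chi):\chi\in\mathcal{C}, A\text{ a cell of }\chi\}$, distinct vertices $(A,\chi),(A',\chi')$ adjacent iff $A\cap A'\ne\emptyset$. A triangulation of a graph $G$ is a chordal graph obtained from $G$ by adding edges; it is minimal if no proper subset of the added edges yields a triangulation. A clique tree of a chordal graph $G$ is a pair $(T,\mathcal{K})$ with $T$ a tree and $\mathcal{K}$ a bijection from $V(T)$ onto the maximal cliques of $G$ such that vertices $x,y$ are adjacent iff both lie in some $\mathcal{K}(v)$, and for each vertex $x$ the nodes $v$ with $x\in\mathcal{K}(v)$ induce a connected subtree. An $X$-tree is a pair $(T',\phi)$ where $T'$ is a tree and $\phi:X\to V(T')$ is a map such that every node of degree one or two lies in the image of $\phi$; $T'$ is its underlying tree. Given a clique tree $(T,\mathcal{K})$ of a triangulation of $\operatorname{int}(\mathcal{C})$, a node $v$ is a candidate node for $a\in X$ if $\mathcal{K}(v)$ contains every vertex $(A,\chi)$ of $\operatorname{int}(\mathcal{C})$ with $a\in A$. An $X$-tree induced by $(T,\mathcal{K})$ is obtained by choosing for each $a\in X$ a candidate node $\phi(a)$,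 and then suppressing every node of $T$ not in the image of $\phi$ that has degree two (replacing it and its two incident edges by a single edge). -}

module Defs where

open import Data.Nat using (ℕ; zero; suc; _≤_; _<_; NonZero)
open import Data.Nat.DivMod using (_%_)
open import Data.Fin using (Fin; toℕ; fromℕ)
open import Data.Fin.Subset using (∣_∣)
open import Data.Vec using (tabulate)
open import Data.Bool using (Bool; true; false)
open import Data.Maybe using (Maybe; just)
open import Data.Product using (Σ; ∃; ∃₂; _×_; _,_)
open import Data.Sum using (_⊎_)
open import Data.Empty using (⊥)
open import Relation.Nullary using (¬_)
open import Relation.Binary.PropositionalEquality using (_≡_; _≢_)
open import Function.Definitions using (Injective)
open import Function.Bundles using (_⇔_)

-- A partial character with k cells is a labelling lab : X → Maybe (Fin k);
-- the domain is {a | lab a ≢ nothing}; cell j is {a | lab a ≡ just j};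
-- every cell is nonempty.

record PChar (n : ℕ) : Set where
  field
    k        : ℕ
    lab      : Fin n → Maybe (Fin k)
    nonempty : ∀ (j : Fin k) → ∃ λ a → lab a ≡ just j
open PChar public

SameCell : ∀ {n} → PChar n → Fin n → Fin n → Set
SameCell χ a b = ∃ λ j → lab χ a ≡ just j × lab χ b ≡ just j

SamePartition : ∀ {n} → PChar n → PChar n → Set
SamePartition χ χ' = ∀ a b → SameCell χ a b ⇔ SameCell χ' a b

-- A set 𝒞 of partial characters: a family indexed by Fin m whose members
-- are pairwise distinct partitions.
record CharSet (n : ℕ) : Set where
  field
    m        : ℕ
    chr      : Fin m → PChar n
    distinct : ∀ i i' → SamePartition (chr i) (chr i') → i ≡ i'
open CharSet public

record Graph (V : Set) : Set₁ where
  field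
    Adj   : V → V → Set
    sym   : ∀ {x y} → Adj x y → Adj y x
    irref : ∀ {x} → ¬ Adj x x
open Graph public

-- Partition intersection graph int(𝒞): vertices (χ, A) with A a cell of χ.
IVert : ∀ {n} → CharSet n → Set
IVert 𝒞 = Σ (Fin (m 𝒞)) λ i → Fin (k (chr 𝒞 i))

InCell : ∀ {n} (𝒞 : CharSet n) → IVert 𝒞 → Fin n → Set
InCell 𝒞 (i , j) a = lab (chr 𝒞 i) a ≡ just j

intGraph : ∀ {n} (𝒞 : CharSet n) → Graph (IVert 𝒞)
intGraph 𝒞 = record
  { Adj   = λ x y → x ≢ y × ∃ λ a → InCell 𝒞 x a × InCell 𝒞 y a
  ; sym   = λ { (ne , a , p , q) → (λ e → ne (Relation.Binary.PropositionalEquality.sym e)) , a , q , p }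
  ; irref = λ { (ne , _) → ne Relation.Binary.PropositionalEquality.refl }
  }
  where import Data.Product
        import Relation.Binary.PropositionalEquality

-- Cycles: an injective cyclic sequence c : Fin l → V, consecutive
-- (mod l) entries adjacent.

Consec : (l : ℕ) .{{_ : NonZero l}} → Fin l → Fin l → Set
Consec l i j = toℕ j ≡ suc (toℕ i) % l

NonConsec : (l : ℕ) .{{_ : NonZero l}} → Fin l → Fin l → Set
NonConsec l i j = i ≢ j × ¬ Consec l i j × ¬ Consec l j i

Chordal : ∀ {V} → Graph V → Set
Chordal {V} G = ∀ (l : ℕ) (c : Fin (suc l) → V) → 3 ≤ l → Injective _≡_ _≡_ c
  → (∀ i j → Consec (suc l) i j → Adj G (c i) (c j))
  → ∃₂ λ i j → NonConsec (suc l) i j × Adj G (c i) (c j)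

Subgraph : ∀ {V} → Graph V → Graph V → Set
Subgraph G H = ∀ x y → Adj G x y → Adj H x y

IsTriangulation : ∀ {V} → Graph V → Graph V → Set
IsTriangulation G H = Subgraph G H × Chordal H

IsMinimalTriangulation : ∀ {V} → Graph V → Graph V → Set₁
IsMinimalTriangulation {V} G H = IsTriangulation G H
  × (∀ (H' : Graph V) → IsTriangulation G H' → Subgraph H' H → Subgraph H H')

IsClique : ∀ {V} → Graph V → (V → Bool) → Set
IsClique G Q = ∀ x y → Q x ≡ true → Q y ≡ true → x ≢ y → Adj G x y

MaximalClique : ∀ {V} → Graph V → (V → Bool) → Set
MaximalClique {V} G Q = IsClique G Q
  × (∀ (Q' : V → Bool) → IsClique G Q' → (∀ x → Q x ≡ true → Q' x ≡ true)
       → ∀ x → Q' x ≡ true → Q x ≡ true)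

data Reach {A : Set} (R : A → A → Set) : A → A → Set where
  here  : ∀ {x} → Reach R x x
  there : ∀ {x y z} → R x y → Reach R y z → Reach R x z

record IsTree (t : ℕ) (tadj : Fin t → Fin t → Bool) : Set where
  field
    nonempty  : 0 < t
    symm      : ∀ u v → tadj u v ≡ tadj v u
    irrefl    : ∀ u → tadj u u ≡ false
    connected : ∀ u v → Reach (λ a b → tadj a b ≡ true) u v
    acyclic   : ∀ (l : ℕ) (c : Fin (suc l) → Fin t) → 2 ≤ l → Injective _≡_ _≡_ c
                → ¬ (∀ i j → Consec (suc l) i j → tadj (c i) (c j) ≡ true)

InducesConnected : ∀ {t} → (Fin t → Fin t → Bool) → (Fin t → Set) → Set
InducesConnected tadj S = ∀ u v → S u → S v
  → Reach (λ a b → S a × S b × tadj a b ≡ true) u v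

degree : ∀ {t} → (Fin t → Fin t → Bool) → Fin t → ℕ
degree tadj v = ∣ tabulate (tadj v) ∣

record CliqueTree {V : Set} (H : Graph V) : Set where
  field
    t       : ℕ
    tadj    : Fin t → Fin t → Bool
    isTree  : IsTree t tadj
    K       : Fin t → V → Bool
    K-max   : ∀ v → MaximalClique H (K v)
    K-inj   : ∀ u v → (∀ x → K u x ≡ K v x) → u ≡ v
    K-surj  : ∀ Q → MaximalClique H Q → ∃ λ v → ∀ x → K v x ≡ Q x
    adj-iff : ∀ x y → x ≢ y → (Adj H x y ⇔ (∃ λ v → K v x ≡ true × K v y ≡ true))
    subtree : ∀ x → InducesConnected tadj (λ v → K v x ≡ true)
open CliqueTree public

module _ {n} {𝒞 : CharSet n} {H : Graph (IVert 𝒞)} (CT : CliqueTree H) where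

  Candidate : Fin n → Fin (t CT) → Set
  Candidate a v = ∀ (x : IVert 𝒞) → InCell 𝒞 x a → K CT v x ≡ true

  -- nodes surviving the suppression step for the choice φ
  Kept : (Fin n → Fin (t CT)) → Fin (t CT) → Set
  Kept φ v = (∃ λ a → φ a ≡ v) ⊎ ¬ (degree (tadj CT) v ≡ 2)

  -- edges of the tree after suppression: u, v kept and joined in T by a
  -- path (injective sequence) all of whose interior nodes are suppressed
  SuppAdj : (Fin n → Fin (t CT)) → Fin (t CT) → Fin (t CT) → Set
  SuppAdj φ u v = Kept φ u × Kept φ v ×
    ∃ λ l → ∃ λ (p : Fin (suc (suc l)) → Fin (t CT)) →
      Injective _≡_ _≡_ p × p Data.Fin.zero ≡ u × p (fromℕ (suc l)) ≡ v
      × (∀ (i : Fin (suc l)) → tadj CT (p (Data.Fin.inject₁ i)) (p (Data.Fin.suc i)) ≡ true)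
      × (∀ (i : Fin l) → ¬ Kept φ (p (Data.Fin.suc (Data.Fin.inject₁ i))))
    where import Data.Fin

  -- the resulting (X-tree) satisfies: every node of degree 1 or 2 is in
  -- the image of φ
  IsXTreeResult : (Fin n → Fin (t CT)) → Set
  IsXTreeResult φ = ∀ v → Kept φ v
    → (∃ λ w → SuppAdj φ v w)
    → (∃₂ λ w₁ w₂ → ∀ w → SuppAdj φ v w → w ≡ w₁ ⊎ w ≡ w₂)
    → ∃ λ a → φ a ≡ v

  InducesXTree : (Fin n → Fin (t CT)) → Set
  InducesXTree φ = (∀ a → Candidate a (φ a)) × IsXTreeResult φ

  UnderlyingTreeIsT : (Fin n → Fin (t CT)) → Set
  UnderlyingTreeIsT φ = (∀ v → Kept φ v)
    × (∀ u v → SuppAdj φ u v ⇔ (tadj CT u v ≡ true))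

-- Suppression only removes unlabelled nodes of degree two, so it suffices that every node v of T with
-- exactly two neighbours u, w is some φ a. Suppose not. Every vertex of 𝒦(v) then lies in 𝒦(u) or
-- 𝒦(w): its cell contains some a, and the candidate node φ a ≠ v contains it too. The sets
-- P = 𝒦(v) ∩ 𝒦(u) ∖ 𝒦(w) and Q = 𝒦(v) ∩ 𝒦(w) ∖ 𝒦(u) are nonempty, as distinct maximal cliques are
-- incomparable, and are joined in H. Deleting the P–Q edges from H leaves a graph H′ that still
-- contains int(𝒞), since two cells sharing an element a lie in 𝒦(φ a) and φ a is on one side of v.
-- H′ is still chordal: a chord of a cycle joining P to Q can be replaced by one joining two vertices of
-- 𝒦(u) ∩ 𝒦(v) ∩ 𝒦(w), met on the two arcs of the cycle between its ends. This contradicts minimality.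

module Submission where

open import Data.Bool using (Bool; true; false)
open import Data.Bool.Properties using (⇔→≡)
import Data.Bool.Properties as Bool
open import Data.Empty using (⊥; ⊥-elim)
open import Data.Fin using (Fin; zero; suc; toℕ; _≟_)
open import Data.Fin.Properties using (toℕ-injective; toℕ<n; toℕ≤pred[n]; toℕ-fromℕ<; any?)
  renaming (suc-injective to suc-injectiveᶠ)
open import Data.Fin.Subset using (∣_∣)
open import Data.List using (List; []; _∷_; length; lookup)
open import Data.List.Membership.Propositional using (_∈_)
open import Data.List.Membership.Propositional.Properties using (∈-lookup)
open import Data.List.Relation.Unary.All using (All; []; _∷_)
import Data.List.Relation.Unary.All as All
open import Data.List.Relation.Unary.All.Properties using (¬Any⇒All¬)
open import Data.List.Relation.Unary.Any using (here; there)
open import Data.List.Relation.Unary.Unique.Propositional using (Unique; []; _∷_)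
open import Data.Nat using (ℕ; suc; _+_; _∸_; _≤_; _<_; _≤′_; ≤′-refl; ≤′-step; z≤n; s≤s; NonZero; _<?_)
  renaming (_≟_ to _≟ℕ_)
open import Data.Nat.DivMod using (_%_; _mod_; %-distribˡ-+; m%n%n≡m%n; [m+n]%n≡m%n; m<n⇒m%n≡m; m%n<n; n%n≡0)
open import Data.Nat.Properties
  using (suc-injective; ≤-refl; ≤-antisym; ≮⇒≥; <⇒≤; <⇒≢; <-asym; <-trans; ≤-<-trans; ≤∧≢⇒<; n<1+n;
         m≤n⇒m≤1+n; m<n⇒m<1+n; m≤n⇒m<n∨m≡n; ≤⇒≤′; ≤′⇒≤; +-comm; +-assoc; +-suc; +-identityʳ; m∸n+n≡m; m+[n∸m]≡n)
open import Data.Product using (∃; ∃₂; _×_; _,_; proj₁; proj₂)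
open import Data.Sum using (_⊎_; inj₁; inj₂)
import Data.Sum as Sum
open import Data.Vec using (tabulate)
open import Function using (_∘_)
open import Function.Bundles using (mk⇔; Equivalence)
open import Function.Definitions using (Injective)
open import Relation.Binary.Definitions using (DecidableEquality)
open import Relation.Binary.PropositionalEquality
open import Relation.Nullary using (¬_; Dec; yes; no)
open import Relation.Nullary.Decidable using (_×-dec_; _⊎-dec_)

open import Defs hiding (sym)

≡true⇒≢false : ∀ {b} → b ≡ true → b ≢ false
≡true⇒≢false refl ()

∣tabulate∣≡0⇒false : ∀ {n} (f : Fin n → Bool) → ∣ tabulate f ∣ ≡ 0 → ∀ x → f x ≡ false
∣tabulate∣≡0⇒false {suc n} f ∣f∣≡0 x with f zero in f₀
∣tabulate∣≡0⇒false {suc n} f () x | true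
∣tabulate∣≡0⇒false {suc n} f ∣f∣≡0 zero | false = f₀
∣tabulate∣≡0⇒false {suc n} f ∣f∣≡0 (suc x) | false = ∣tabulate∣≡0⇒false (f ∘ suc) ∣f∣≡0 x

∣tabulate∣≡1⇒unique : ∀ {n} (f : Fin n → Bool) → ∣ tabulate f ∣ ≡ 1
                    → ∃ λ u → f u ≡ true × ∀ x → f x ≡ true → x ≡ u
∣tabulate∣≡1⇒unique {suc n} f ∣f∣≡1 with f zero in f₀
... | true = zero , f₀ , λ where
  zero    _   → refl
  (suc x) fx → ⊥-elim (≡true⇒≢false fx (∣tabulate∣≡0⇒false (f ∘ suc) (suc-injective ∣f∣≡1) x))
... | false with ∣tabulate∣≡1⇒unique (f ∘ suc) ∣f∣≡1
...   | u , fu , unique = suc u , fu , λ where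
  zero    f₀′ → ⊥-elim (≡true⇒≢false f₀′ f₀)
  (suc x) fx  → cong suc (unique x fx)

∣tabulate∣≡2⇒pair : ∀ {n} (f : Fin n → Bool) → ∣ tabulate f ∣ ≡ 2
                  → ∃₂ λ u w → u ≢ w × f u ≡ true × f w ≡ true × ∀ x → f x ≡ true → x ≡ u ⊎ x ≡ w
∣tabulate∣≡2⇒pair {suc n} f ∣f∣≡2 with f zero in f₀
... | true with ∣tabulate∣≡1⇒unique (f ∘ suc) (suc-injective ∣f∣≡2)
...   | w , fw , unique = zero , suc w , (λ ()) , f₀ , fw , λ where
  zero    _  → inj₁ refl
  (suc x) fx → inj₂ (cong suc (unique x fx))
∣tabulate∣≡2⇒pair {suc n} f ∣f∣≡2 | false with ∣tabulate∣≡2⇒pair (f ∘ suc) ∣f∣≡2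
...   | u , w , u≢w , fu , fw , pair = suc u , suc w , u≢w ∘ suc-injectiveᶠ , fu , fw , λ where
  zero    f₀′ → ⊥-elim (≡true⇒≢false f₀′ f₀)
  (suc x) fx  → Sum.map (cong suc) (cong suc) (pair x fx)

module _ {A : Set} where

  Within : (A → Set) → (A → A → Set) → A → A → Set
  Within S R a b = S a × S b × R a b

  Within-sym : ∀ {S R} → (∀ {a b} → R a b → R b a) → ∀ {a b} → Within S R a b → Within S R b a
  Within-sym R-sym (Sa , Sb , r) = Sb , Sa , R-sym r

  Avoiding : A → (A → A → Set) → A → A → Set
  Avoiding v = Within (_≢ v)

  _++ᴿ_ : ∀ {R : A → A → Set} {a b c} → Reach R a b → Reach R b c → Reach R a c
  here      ++ᴿ q = q
  there r p ++ᴿ q = there r (p ++ᴿ q)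

  reverseᴿ : ∀ {R : A → A → Set} → (∀ {a b} → R a b → R b a) → ∀ {a b} → Reach R a b → Reach R b a
  reverseᴿ R-sym here        = here
  reverseᴿ R-sym (there r p) = reverseᴿ R-sym p ++ᴿ there (R-sym r) here

  mapᴿ : ∀ {R S : A → A → Set} → (∀ {a b} → R a b → S a b) → ∀ {a b} → Reach R a b → Reach S a b
  mapᴿ f here        = here
  mapᴿ f (there r p) = there (f r) (mapᴿ f p)

  module _ (_≟_ : DecidableEquality A) {R : A → A → Set} {v : A} where

    lastExit : ∀ {z} → Reach R v z → z ≢ v → ∃ λ m → R v m × Reach (Avoiding v R) m z
    lastExit {z} p z≢v with split p
      where
      split : ∀ {s} → Reach R s z
            → (s ≢ v × Reach (Avoiding v R) s z) ⊎ ∃ λ m → R v m × Reach (Avoiding v R) m z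
      split here = inj₁ (z≢v , here)
      split {s} (there r p) with split p | s ≟ v
      ... | inj₂ exit        | _        = inj₂ exit
      ... | inj₁ (m≢v , q)   | yes refl = inj₂ (_ , r , q)
      ... | inj₁ (m≢v , q)   | no s≢v   = inj₁ (s≢v , there (s≢v , m≢v , r) q)
    ... | inj₁ (v≢v , _) = ⊥-elim (v≢v refl)
    ... | inj₂ exit      = exit

  lookup-injective : ∀ {xs : List A} → Unique xs → Injective _≡_ _≡_ (lookup xs)
  lookup-injective (x∉ ∷ u) {zero}  {zero}  _ = refl
  lookup-injective (x∉ ∷ u) {zero}  {suc j} e = ⊥-elim (All.lookup x∉ (∈-lookup j) e)
  lookup-injective (x∉ ∷ u) {suc i} {zero}  e = ⊥-elim (All.lookup x∉ (∈-lookup i) (sym e))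
  lookup-injective (x∉ ∷ u) {suc i} {suc j} e = cong suc (lookup-injective u e)

  data Walk (R : A → A → Set) : A → A → List A → Set where
    end : ∀ {a} → Walk R a a []
    _◅_ : ∀ {a b c xs} → R a b → Walk R b c xs → Walk R a c (b ∷ xs)

  module _ {R : A → A → Set} where

    mapʷ : ∀ {S : A → A → Set} → (∀ {a b} → R a b → S a b) → ∀ {a b xs} → Walk R a b xs → Walk S a b xs
    mapʷ f end     = end
    mapʷ f (r ◅ w) = f r ◅ mapʷ f w

    Walk-All : ∀ {S : A → Set} → (∀ {a b} → R a b → S b) → ∀ {a b xs} → Walk R a b xs → All S xs
    Walk-All target end     = []
    Walk-All target (r ◅ w) = target r ∷ Walk-All target w

    Walk-link : ∀ {a b xs} → Walk R a b xs
              → ∀ i j → toℕ j ≡ suc (toℕ i) → R (lookup (a ∷ xs) i) (lookup (a ∷ xs) j)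
    Walk-link (r ◅ w) zero    (suc zero) _ = r
    Walk-link (r ◅ w) (suc i) (suc j)    e = Walk-link w i j (suc-injective e)

    Walk-last : ∀ {a b xs} → Walk R a b xs → ∀ i → toℕ i ≡ length xs → lookup (a ∷ xs) i ≡ b
    Walk-last end     zero    _ = refl
    Walk-last (r ◅ w) (suc i) e = Walk-last w i (suc-injective e)

    closedWalk-cyclic : ∀ {a b xs} → Walk R a b xs → R b a
                      → ∀ i j → Consec (suc (length xs)) i j → R (lookup (a ∷ xs) i) (lookup (a ∷ xs) j)
    closedWalk-cyclic {a} {b} {xs} w ba i j i→j with suc (toℕ i) <? suc (length xs)
    ... | yes i<last = Walk-link w i j (trans i→j (m<n⇒m%n≡m i<last))
    ... | no  i≮last = subst₂ R (sym (Walk-last w i i≡last)) (cong (lookup (a ∷ xs)) (sym j≡0)) ba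
      where
      i≡last : toℕ i ≡ length xs
      i≡last = ≤-antisym (toℕ≤pred[n] i) (≮⇒≥ (i≮last ∘ s≤s))
      j≡0 : j ≡ zero
      j≡0 = toℕ-injective (trans i→j (trans (cong (λ k → suc k % suc (length xs)) i≡last)
                                            (n%n≡0 (suc (length xs)))))

    module _ (_≟_ : DecidableEquality A) where
      open import Data.List.Membership.DecPropositional _≟_ using (_∈?_)

      suffix : ∀ {x y b ys} → Walk R y b ys → Unique (y ∷ ys) → x ∈ y ∷ ys
             → ∃ λ zs → Walk R x b zs × Unique (x ∷ zs)
      suffix w       u         (here refl) = _ , w , u
      suffix (r ◅ w) (_ ∷ u)   (there x∈)  = suffix w u x∈

      Reach⇒simpleWalk : ∀ {a b} → Reach R a b → ∃ λ xs → Walk R a b xs × Unique (a ∷ xs)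
      Reach⇒simpleWalk here = [] , end , [] ∷ []
      Reach⇒simpleWalk {a} (there {y = y} r p) with Reach⇒simpleWalk p
      ... | ys , w , u with a ∈? y ∷ ys
      ...   | yes a∈ = suffix w u a∈
      ...   | no  a∉ = _ , r ◅ w , ¬Any⇒All¬ _ a∉ ∷ u

module _ {t : ℕ} {tadj : Fin t → Fin t → Bool} (T : IsTree t tadj) where

  Edge : Fin t → Fin t → Set
  Edge a b = tadj a b ≡ true

  Edge-sym : ∀ {a b} → Edge a b → Edge b a
  Edge-sym {a} {b} ab = trans (IsTree.symm T b a) ab

  Edge⇒≢ : ∀ {a b} → Edge a b → a ≢ b
  Edge⇒≢ {a} ab refl = ≡true⇒≢false ab (IsTree.irrefl T a)

  neighbours-separated : ∀ {v u w} → Edge v u → Edge v w → u ≢ w → ¬ Reach (Avoiding v Edge) u w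
  neighbours-separated {v} {u} {w} vu vw u≢w p with Reach⇒simpleWalk _≟_ p
  ... | [] , end , _ = u≢w refl
  ... | ys@(_ ∷ _) , walk , unique =
    IsTree.acyclic T (length (u ∷ ys)) (lookup cycle) (s≤s (s≤s z≤n)) (lookup-injective cycle-unique)
      (closedWalk-cyclic (vu ◅ mapʷ (λ (_ , _ , e) → e) walk) (Edge-sym vw))
    where
    cycle = v ∷ u ∷ ys
    cycle-unique : Unique cycle
    cycle-unique = (Edge⇒≢ vu ∷ All.map ≢-sym (Walk-All (λ (_ , b≢v , _) → b≢v) walk)) ∷ unique

[m+n%d]%d≡[m+n]%d : ∀ m n d .{{_ : NonZero d}} → (m + n % d) % d ≡ (m + n) % d
[m+n%d]%d≡[m+n]%d m n d = begin
  (m + n % d) % d             ≡⟨ %-distribˡ-+ m (n % d) d ⟩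
  (m % d + n % d % d) % d     ≡⟨ cong (λ k → (m % d + k) % d) (m%n%n≡m%n n d) ⟩
  (m % d + n % d) % d         ≡⟨ %-distribˡ-+ m n d ⟨
  (m + n) % d                 ∎
  where open ≡-Reasoning

[d+n]%d≡n%d : ∀ d n .{{_ : NonZero d}} → (d + n) % d ≡ n % d
[d+n]%d≡n%d d n = trans (cong (_% d) (+-comm d n)) ([m+n]%n≡m%n n d)

module _ {P Q : ℕ → Set} where

  propagate-up : ∀ {a b} → a ≤′ b → P a → (∀ k → P k → P (suc k) ⊎ Q (suc k))
               → P b ⊎ ∃ λ k → a < k × k ≤ b × Q k
  propagate-up ≤′-refl Pa step = inj₁ Pa
  propagate-up (≤′-step {n} a≤′n) Pa step with propagate-up a≤′n Pa step
  ... | inj₂ (k , a<k , k≤n , Qk) = inj₂ (k , a<k , m≤n⇒m≤1+n k≤n , Qk)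
  ... | inj₁ Pn = Sum.map₂ (λ Qsn → suc n , s≤s (≤′⇒≤ a≤′n) , ≤-refl , Qsn) (step n Pn)

  propagate-down : ∀ {a b} → a ≤′ b → P b → (∀ k → P (suc k) → P k ⊎ Q k)
                 → P a ⊎ ∃ λ k → a ≤ k × k < b × Q k
  propagate-down ≤′-refl Pb step = inj₁ Pb
  propagate-down (≤′-step {n} a≤′n) Psn step with step n Psn
  ... | inj₂ Qn = inj₂ (n , ≤′⇒≤ a≤′n , ≤-refl , Qn)
  ... | inj₁ Pn = Sum.map₂ (λ (k , a≤k , k<n , Qk) → k , a≤k , m<n⇒m<1+n k<n , Qk) (propagate-down a≤′n Pn step)

module _ {L : ℕ} .{{_ : NonZero L}} where

  Consec-functional : ∀ {i j j′} → Consec L i j → Consec L i j′ → j ≡ j′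
  Consec-functional i→j i→j′ = toℕ-injective (trans i→j (sym i→j′))

  rotate : Fin L → ℕ → Fin L
  rotate i k = (toℕ i + k) mod L

  toℕ-rotate : ∀ i k → toℕ (rotate i k) ≡ (toℕ i + k) % L
  toℕ-rotate i k = toℕ-fromℕ< (m%n<n (toℕ i + k) L)

  rotate-zero : ∀ i → rotate i 0 ≡ i
  rotate-zero i = toℕ-injective (begin
    toℕ (rotate i 0)   ≡⟨ toℕ-rotate i 0 ⟩
    (toℕ i + 0) % L    ≡⟨ cong (_% L) (+-identityʳ (toℕ i)) ⟩
    toℕ i % L          ≡⟨ m<n⇒m%n≡m (toℕ<n i) ⟩
    toℕ i              ∎)
    where open ≡-Reasoning

  rotate-period : ∀ i → rotate i L ≡ i
  rotate-period i = toℕ-injective (begin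
    toℕ (rotate i L)   ≡⟨ toℕ-rotate i L ⟩
    (toℕ i + L) % L    ≡⟨ [m+n]%n≡m%n (toℕ i) L ⟩
    toℕ i % L          ≡⟨ m<n⇒m%n≡m (toℕ<n i) ⟩
    toℕ i              ∎)
    where open ≡-Reasoning

  rotate-suc : ∀ i k → Consec L (rotate i k) (rotate i (suc k))
  rotate-suc i k = begin
    toℕ (rotate i (suc k))        ≡⟨ toℕ-rotate i (suc k) ⟩
    (toℕ i + suc k) % L           ≡⟨ cong (_% L) (+-suc (toℕ i) k) ⟩
    suc (toℕ i + k) % L           ≡⟨ [m+n%d]%d≡[m+n]%d 1 (toℕ i + k) L ⟨
    suc ((toℕ i + k) % L) % L     ≡⟨ cong (λ m → suc m % L) (toℕ-rotate i k) ⟨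
    suc (toℕ (rotate i k)) % L    ∎
    where open ≡-Reasoning

  unrotate : ∀ i k → (L ∸ toℕ i + toℕ (rotate i k)) % L ≡ k % L
  unrotate i k = begin
    (L ∸ toℕ i + toℕ (rotate i k)) % L     ≡⟨ cong (λ m → (L ∸ toℕ i + m) % L) (toℕ-rotate i k) ⟩
    (L ∸ toℕ i + (toℕ i + k) % L) % L      ≡⟨ [m+n%d]%d≡[m+n]%d (L ∸ toℕ i) (toℕ i + k) L ⟩
    (L ∸ toℕ i + (toℕ i + k)) % L          ≡⟨ cong (_% L) (+-assoc (L ∸ toℕ i) (toℕ i) k) ⟨
    (L ∸ toℕ i + toℕ i + k) % L            ≡⟨ cong (λ m → (m + k) % L) (m∸n+n≡m (<⇒≤ (toℕ<n i))) ⟩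
    (L + k) % L                            ≡⟨ [d+n]%d≡n%d L k ⟩
    k % L                                  ∎
    where open ≡-Reasoning

  rotate-injective : ∀ i {a b} → a < L → b < L → rotate i a ≡ rotate i b → a ≡ b
  rotate-injective i {a} {b} a<L b<L eq = begin
    a                                      ≡⟨ m<n⇒m%n≡m a<L ⟨
    a % L                                  ≡⟨ unrotate i a ⟨
    (L ∸ toℕ i + toℕ (rotate i a)) % L     ≡⟨ cong (λ j → (L ∸ toℕ i + toℕ j) % L) eq ⟩
    (L ∸ toℕ i + toℕ (rotate i b)) % L     ≡⟨ unrotate i b ⟩
    b % L                                  ≡⟨ m<n⇒m%n≡m b<L ⟩
    b                                      ∎
    where open ≡-Reasoning

  rotate-surjective : ∀ i j → ∃ λ d → d < L × rotate i d ≡ j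
  rotate-surjective i j = d , m%n<n (L ∸ toℕ i + toℕ j) L , toℕ-injective (begin
    toℕ (rotate i d)                      ≡⟨ toℕ-rotate i d ⟩
    (toℕ i + d) % L                       ≡⟨ [m+n%d]%d≡[m+n]%d (toℕ i) (L ∸ toℕ i + toℕ j) L ⟩
    (toℕ i + (L ∸ toℕ i + toℕ j)) % L     ≡⟨ cong (_% L) (+-assoc (toℕ i) (L ∸ toℕ i) (toℕ j)) ⟨
    (toℕ i + (L ∸ toℕ i) + toℕ j) % L     ≡⟨ cong (λ m → (m + toℕ j) % L) (m+[n∸m]≡n (<⇒≤ (toℕ<n i))) ⟩
    (L + toℕ j) % L                       ≡⟨ [d+n]%d≡n%d L (toℕ j) ⟩
    toℕ j % L                             ≡⟨ m<n⇒m%n≡m (toℕ<n j) ⟩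
    toℕ j                                 ∎)
    where
    d = (L ∸ toℕ i + toℕ j) % L
    open ≡-Reasoning

  rotate-NonConsec : ∀ i {a b} → 0 < a → suc a < b → b < L → NonConsec L (rotate i a) (rotate i b)
  rotate-NonConsec i {a} {b} 0<a 1+a<b b<L = a≢b , ¬a→b , ¬b→a
    where
    a<b   = <-trans (n<1+n a) 1+a<b
    1+a<L = <-trans 1+a<b b<L
    a<L   = <-trans a<b b<L
    a≢b : rotate i a ≢ rotate i b
    a≢b e = <⇒≢ a<b (rotate-injective i a<L b<L e)
    ¬a→b : ¬ Consec L (rotate i a) (rotate i b)
    ¬a→b e = <⇒≢ 1+a<b (sym (rotate-injective i b<L 1+a<L (Consec-functional e (rotate-suc i a))))
    ¬b→a : ¬ Consec L (rotate i b) (rotate i a)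
    ¬b→a e with m≤n⇒m<n∨m≡n b<L
    ... | inj₁ 1+b<L = <-asym (subst (_< b) (rotate-injective i a<L 1+b<L a≡1+b) a<b) (n<1+n b)
      where a≡1+b = Consec-functional e (rotate-suc i b)
    ... | inj₂ refl = <⇒≢ 0<a (sym (rotate-injective i a<L (s≤s z≤n) a≡0))
      where a≡0 = trans (Consec-functional e (rotate-suc i b)) (trans (rotate-period i) (sym (rotate-zero i)))

module _ {V : Set} {L : ℕ} .{{_ : NonZero L}} (c : Fin L → V) {E : V → V → Set}
         (cyclic : ∀ i j → Consec L i j → E (c i) (c j)) (E-sym : ∀ {x y} → E x y → E y x)
         {G M : V → Set} (step : ∀ {x y} → E x y → G x → G y ⊎ M y) where

  -- G is left only into M, so both arcs of the cycle between i and j meet M; positions on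
  -- different arcs are separated by i and j, hence not consecutive.
  leaving-crosses-twice : ∀ {i j} → G (c i) → ¬ G (c j) → ¬ M (c j)
                        → ∃₂ λ k₁ k₂ → NonConsec L k₁ k₂ × M (c k₁) × M (c k₂)
  leaving-crosses-twice {i} {j} Gi ¬Gj ¬Mj with rotate-surjective i j
  ... | d , d<L , refl with forward | backward
    where
    f = c ∘ rotate i
    forward : ∃ λ k → 0 < k × k < d × M (f k)
    forward with propagate-up {P = G ∘ f} {Q = M ∘ f} (≤⇒≤′ z≤n) (subst (G ∘ c) (sym (rotate-zero i)) Gi)
                              (λ k → step (cyclic _ _ (rotate-suc i k)))
    ... | inj₁ Gd = ⊥-elim (¬Gj Gd)
    ... | inj₂ (k , 0<k , k≤d , Mk) = k , 0<k , ≤∧≢⇒< k≤d (λ { refl → ¬Mj Mk }) , Mk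
    backward : ∃ λ k → d < k × k < L × M (f k)
    backward with propagate-down {P = G ∘ f} {Q = M ∘ f} (≤⇒≤′ (<⇒≤ d<L)) (subst (G ∘ c) (sym (rotate-period i)) Gi)
                                 (λ k → step (E-sym (cyclic _ _ (rotate-suc i k))))
    ... | inj₁ Gd = ⊥-elim (¬Gj Gd)
    ... | inj₂ (k , d≤k , k<L , Mk) = k , ≤∧≢⇒< d≤k (λ { refl → ¬Mj Mk }) , k<L , Mk
  ... | k₁ , 0<k₁ , k₁<d , Mk₁ | k₂ , d<k₂ , k₂<L , Mk₂ =
    rotate i k₁ , rotate i k₂ , rotate-NonConsec i 0<k₁ (≤-<-trans k₁<d d<k₂) k₂<L , Mk₁ , Mk₂

deleteEdges : ∀ {V} (G : Graph V) (B : V → V → Set) → (∀ {x y} → B x y → B y x) → Graph V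
deleteEdges G B B-sym = record
  { Adj   = λ x y → Adj G x y × ¬ B x y
  ; sym   = λ (xy , ¬b) → Graph.sym G xy , ¬b ∘ B-sym
  ; irref = λ (xx , _) → irref G xx
  }

module _ {V : Set} {H : Graph V} (CT : CliqueTree H) where

  K-⊆⇒≡ : ∀ {u v} → (∀ x → K CT v x ≡ true → K CT u x ≡ true) → u ≡ v
  K-⊆⇒≡ {u} {v} v⊆u = K-inj CT u v (λ x → ⇔→≡ (mk⇔ (u⊆v x) (v⊆u x)))
    where
    u⊆v : ∀ x → K CT u x ≡ true → K CT v x ≡ true
    u⊆v = proj₂ (K-max CT v) (K CT u) (proj₁ (K-max CT u)) v⊆u

  K-⊈ : ∀ {u v} → u ≢ v → ¬ ¬ ∃ λ x → K CT v x ≡ true × K CT u x ≡ false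
  K-⊈ {u} {v} u≢v ∄x = u≢v (K-⊆⇒≡ v⊆u)
    where
    v⊆u : ∀ x → K CT v x ≡ true → K CT u x ≡ true
    v⊆u x x∈v with K CT u x in x∈?u
    ... | true  = refl
    ... | false = ⊥-elim (∄x (x , x∈v , x∈?u))

  common-clique : ∀ {x y} → Adj H x y → ∃ λ z → K CT z x ≡ true × K CT z y ≡ true
  common-clique {x} {y} xy = Equivalence.to (adj-iff CT x y λ { refl → irref H xy }) xy

  co-clique⇒Adj : ∀ {x y z} → x ≢ y → K CT z x ≡ true → K CT z y ≡ true → Adj H x y
  co-clique⇒Adj {x} {y} {z} x≢y x∈z y∈z = Equivalence.from (adj-iff CT x y x≢y) (z , x∈z , y∈z)

module UnlabelledDegreeTwoNode
  {n} {𝒞 : CharSet n} {H : Graph (IVert 𝒞)} (minimal : IsMinimalTriangulation (intGraph 𝒞) H)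
  (CT : CliqueTree H) {φ : Fin n → Fin (t CT)} (candidate : ∀ a → Candidate {n} {𝒞} CT a (φ a))
  {v u w : Fin (t CT)} (u≢w : u ≢ w) (vu : tadj CT v u ≡ true) (vw : tadj CT v w ≡ true)
  (only : ∀ z → tadj CT v z ≡ true → z ≡ u ⊎ z ≡ w) (unlabelled : ∀ a → φ a ≢ v) where

  private
    T = isTree CT

  _∈ᴷ_ _∉ᴷ_ : IVert 𝒞 → Fin (t CT) → Set
  x ∈ᴷ z = K CT z x ≡ true
  x ∉ᴷ z = K CT z x ≡ false

  ∈ᴷ⊎∉ᴷ : ∀ x z → x ∈ᴷ z ⊎ x ∉ᴷ z
  ∈ᴷ⊎∉ᴷ x z with K CT z x
  ... | true  = inj₁ refl
  ... | false = inj₂ refl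

  ∉ᴷ⇒≢ : ∀ {x z z′} → x ∉ᴷ z → x ∈ᴷ z′ → z′ ≢ z
  ∉ᴷ⇒≢ x∉z x∈z′ refl = ≡true⇒≢false x∈z′ x∉z

  Side : Fin (t CT) → Fin (t CT) → Set
  Side = Reach (Avoiding v (Edge T))

  sides-disjoint : ∀ {z} → Side u z → Side w z → ⊥
  sides-disjoint uz wz = neighbours-separated T vu vw u≢w (uz ++ᴿ reverseᴿ (Within-sym {S = _≢ v} (Edge-sym T)) wz)

  side : ∀ {z} → z ≢ v → Side u z ⊎ Side w z
  side {z} z≢v with lastExit _≟_ (IsTree.connected T v z) z≢v
  ... | m , vm , mz with only m vm
  ...   | inj₁ refl = inj₁ mz
  ...   | inj₂ refl = inj₂ mz

  exit-neighbour : ∀ {x z} → x ∈ᴷ v → x ∈ᴷ z → z ≢ v → ∃ λ m → (m ≡ u ⊎ m ≡ w) × x ∈ᴷ m × Side m z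
  exit-neighbour {x} {z} x∈v x∈z z≢v with lastExit _≟_ (subtree CT x v z x∈v x∈z) z≢v
  ... | m , (_ , x∈m , vm) , mz = m , only m vm , x∈m , mapᴿ (λ (a≢v , b≢v , (_ , _ , e)) → a≢v , b≢v , e) mz

  side-u : ∀ {x z} → x ∈ᴷ v → x ∉ᴷ w → x ∈ᴷ z → z ≢ v → Side u z
  side-u x∈v x∉w x∈z z≢v with exit-neighbour x∈v x∈z z≢v
  ... | _ , inj₁ refl , _   , uz = uz
  ... | _ , inj₂ refl , x∈w , _  = ⊥-elim (≡true⇒≢false x∈w x∉w)

  side-w : ∀ {x z} → x ∈ᴷ v → x ∉ᴷ u → x ∈ᴷ z → z ≢ v → Side w z
  side-w x∈v x∉u x∈z z≢v with exit-neighbour x∈v x∈z z≢v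
  ... | _ , inj₂ refl , _   , wz = wz
  ... | _ , inj₁ refl , x∈u , _  = ⊥-elim (≡true⇒≢false x∈u x∉u)

  K-v⊆K-u∪K-w : ∀ {x} → x ∈ᴷ v → x ∈ᴷ u ⊎ x ∈ᴷ w
  K-v⊆K-u∪K-w {x@(i , j)} x∈v with nonempty (chr 𝒞 i) j
  ... | a , a∈x with exit-neighbour x∈v (candidate a x a∈x) (unlabelled a)
  ...   | _ , inj₁ refl , x∈u , _ = inj₁ x∈u
  ...   | _ , inj₂ refl , x∈w , _ = inj₂ x∈w

  P Q M : IVert 𝒞 → Set
  P x = x ∈ᴷ v × x ∈ᴷ u × x ∉ᴷ w
  Q x = x ∈ᴷ v × x ∈ᴷ w × x ∉ᴷ u
  M x = x ∈ᴷ v × x ∈ᴷ u × x ∈ᴷ w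

  ∉ᴷ-w⇒P : ∀ {x} → x ∈ᴷ v → x ∉ᴷ w → P x
  ∉ᴷ-w⇒P x∈v x∉w with K-v⊆K-u∪K-w x∈v
  ... | inj₁ x∈u = x∈v , x∈u , x∉w
  ... | inj₂ x∈w = ⊥-elim (≡true⇒≢false x∈w x∉w)

  ∉ᴷ-u⇒Q : ∀ {x} → x ∈ᴷ v → x ∉ᴷ u → Q x
  ∉ᴷ-u⇒Q x∈v x∉u with K-v⊆K-u∪K-w x∈v
  ... | inj₁ x∈u = ⊥-elim (≡true⇒≢false x∈u x∉u)
  ... | inj₂ x∈w = x∈v , x∈w , x∉u

  Crossing : IVert 𝒞 → IVert 𝒞 → Set
  Crossing x y = (P x × Q y) ⊎ (Q x × P y)

  Crossing-sym : ∀ {x y} → Crossing x y → Crossing y x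
  Crossing-sym (inj₁ (Px , Qy)) = inj₂ (Qy , Px)
  Crossing-sym (inj₂ (Qx , Py)) = inj₁ (Py , Qx)

  Crossing? : ∀ x y → Dec (Crossing x y)
  Crossing? x y = (P? x ×-dec Q? y) ⊎-dec (Q? x ×-dec P? y)
    where
    P? : ∀ x → Dec (P x)
    Q? : ∀ x → Dec (Q x)
    P? x = (K CT v x Bool.≟ true) ×-dec (K CT u x Bool.≟ true) ×-dec (K CT w x Bool.≟ false)
    Q? x = (K CT v x Bool.≟ true) ×-dec (K CT w x Bool.≟ true) ×-dec (K CT u x Bool.≟ false)

  H′ : Graph (IVert 𝒞)
  H′ = deleteEdges H Crossing Crossing-sym

  ¬crossing-off-v : ∀ {x y z} → z ≢ v → x ∈ᴷ z → y ∈ᴷ z → ¬ (P x × Q y)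
  ¬crossing-off-v z≢v x∈z y∈z ((x∈v , _ , x∉w) , (y∈v , _ , y∉u)) =
    sides-disjoint (side-u x∈v x∉w x∈z z≢v) (side-w y∈v y∉u y∈z z≢v)

  int⊆H′ : Subgraph (intGraph 𝒞) H′
  int⊆H′ x y xy@(_ , a , a∈x , a∈y) = proj₁ (proj₁ minimal) x y xy , λ where
    (inj₁ PxQy) → ¬crossing-off-v (unlabelled a) (candidate a x a∈x) (candidate a y a∈y) PxQy
    (inj₂ (Qx , Py)) → ¬crossing-off-v (unlabelled a) (candidate a y a∈y) (candidate a x a∈x) (Py , Qx)

  -- The subtree of x lies in u's side of T − v, together with v.
  OnU : IVert 𝒞 → Set
  OnU x = (x ∈ᴷ v × x ∉ᴷ w) ⊎ (x ∉ᴷ v × ∃ λ z → x ∈ᴷ z × Side u z)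

  OnU-step-within-K-v : ∀ {x y} → ¬ Crossing x y → x ∈ᴷ v → y ∈ᴷ v → OnU x → OnU y ⊎ M y
  OnU-step-within-K-v ¬cross x∈v y∈v (inj₂ (x∉v , _)) = ⊥-elim (≡true⇒≢false x∈v x∉v)
  OnU-step-within-K-v {x} {y} ¬cross x∈v y∈v (inj₁ (_ , x∉w)) with ∈ᴷ⊎∉ᴷ y w | ∈ᴷ⊎∉ᴷ y u
  ... | inj₂ y∉w | _        = inj₁ (inj₁ (y∈v , y∉w))
  ... | inj₁ y∈w | inj₁ y∈u = inj₂ (y∈v , y∈u , y∈w)
  ... | inj₁ y∈w | inj₂ y∉u = ⊥-elim (¬cross (inj₁ (∉ᴷ-w⇒P x∈v x∉w , (y∈v , y∈w , y∉u))))

  u-side⇒OnU⊎M : ∀ {y z} → z ≢ v → y ∈ᴷ z → Side u z → OnU y ⊎ M y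
  u-side⇒OnU⊎M {y} {z} z≢v y∈z uz with ∈ᴷ⊎∉ᴷ y v | ∈ᴷ⊎∉ᴷ y w | ∈ᴷ⊎∉ᴷ y u
  ... | inj₂ y∉v | _        | _        = inj₁ (inj₂ (y∉v , z , y∈z , uz))
  ... | inj₁ y∈v | inj₂ y∉w | _        = inj₁ (inj₁ (y∈v , y∉w))
  ... | inj₁ y∈v | inj₁ y∈w | inj₁ y∈u = inj₂ (y∈v , y∈u , y∈w)
  ... | inj₁ y∈v | inj₁ y∈w | inj₂ y∉u = ⊥-elim (sides-disjoint uz (side-w y∈v y∉u y∈z z≢v))

  w-side⇒¬OnU : ∀ {x z} → z ≢ v → x ∈ᴷ z → Side w z → ¬ OnU x
  w-side⇒¬OnU z≢v x∈z wz (inj₁ (x∈v , x∉w)) = sides-disjoint (side-u x∈v x∉w x∈z z≢v) wz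
  w-side⇒¬OnU {x} {z} z≢v x∈z wz (inj₂ (x∉v , z′ , x∈z′ , uz′)) = sides-disjoint (uz′ ++ᴿ z′z) wz
    where
    z′z : Side z′ z
    z′z = mapᴿ (λ (x∈a , x∈b , e) → ∉ᴷ⇒≢ x∉v x∈a , ∉ᴷ⇒≢ x∉v x∈b , e) (subtree CT x z′ z x∈z′ x∈z)

  OnU-step : ∀ {x y} → Adj H′ x y → OnU x → OnU y ⊎ M y
  OnU-step (xy , ¬cross) onU with common-clique CT xy
  ... | z , x∈z , y∈z with z ≟ v
  ...   | yes refl = OnU-step-within-K-v ¬cross x∈z y∈z onU
  ...   | no  z≢v with side z≢v
  ...     | inj₁ uz = u-side⇒OnU⊎M z≢v y∈z uz
  ...     | inj₂ wz = ⊥-elim (w-side⇒¬OnU z≢v x∈z wz onU)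

  M-adjacent : ∀ {x y} → x ≢ y → M x → M y → Adj H′ x y
  M-adjacent x≢y (x∈v , x∈u , x∈w) (y∈v , _ , _) = co-clique⇒Adj CT x≢y x∈v y∈v , λ where
    (inj₁ ((_ , _ , x∉w) , _)) → ≡true⇒≢false x∈w x∉w
    (inj₂ ((_ , _ , x∉u) , _)) → ≡true⇒≢false x∈u x∉u

  H′-chord-at-crossing : ∀ l (c : Fin (suc l) → IVert 𝒞) → Injective _≡_ _≡_ c
                       → (∀ i j → Consec (suc l) i j → Adj H′ (c i) (c j))
                       → ∀ {i j} → P (c i) → Q (c j)
                       → ∃₂ λ i j → NonConsec (suc l) i j × Adj H′ (c i) (c j)
  H′-chord-at-crossing l c c-inj cyclic {i} {j} (ci∈v , _ , ci∉w) (cj∈v , cj∈w , cj∉u)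
    with leaving-crosses-twice c {E = Adj H′} cyclic (Graph.sym H′) {G = OnU} {M = M} OnU-step {i} {j}
           (inj₁ (ci∈v , ci∉w)) ¬OnU-cj (λ (_ , cj∈u , _) → ≡true⇒≢false cj∈u cj∉u)
    where
    ¬OnU-cj : ¬ OnU (c j)
    ¬OnU-cj (inj₁ (_ , cj∉w)) = ≡true⇒≢false cj∈w cj∉w
    ¬OnU-cj (inj₂ (cj∉v , _)) = ≡true⇒≢false cj∈v cj∉v
  ... | k₁ , k₂ , nc@(k₁≢k₂ , _) , Mk₁ , Mk₂ = k₁ , k₂ , nc , M-adjacent {c k₁} {c k₂} (k₁≢k₂ ∘ c-inj) Mk₁ Mk₂

  H′-chordal : Chordal H′
  H′-chordal l c 3≤l c-inj cyclic with proj₂ (proj₁ minimal) l c 3≤l c-inj (λ i j i→j → proj₁ (cyclic i j i→j))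
  ... | i , j , nc , cicj with Crossing? (c i) (c j)
  ...   | no  ¬cross              = i , j , nc , cicj , ¬cross
  ...   | yes (inj₁ (Pci , Qcj)) = H′-chord-at-crossing l c c-inj cyclic Pci Qcj
  ...   | yes (inj₂ (Qci , Pcj)) = H′-chord-at-crossing l c c-inj cyclic Pcj Qci

  H⊆H′ : Subgraph H H′
  H⊆H′ = proj₂ minimal H′ (int⊆H′ , H′-chordal) (λ x y → proj₁)

  ¬P×Q : ∀ {p q} → P p → Q q → ⊥
  ¬P×Q {p} {q} Pp@(p∈v , _ , p∉w) Qq@(q∈v , q∈w , _) = proj₂ (H⊆H′ p q pq) (inj₁ (Pp , Qq))
    where
    pq : Adj H p q
    pq = co-clique⇒Adj CT (λ { refl → ≡true⇒≢false q∈w p∉w }) p∈v q∈v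

  absurd : ⊥
  absurd = K-⊈ CT (≢-sym (Edge⇒≢ T vw)) λ (p , p∈v , p∉w) →
           K-⊈ CT (≢-sym (Edge⇒≢ T vu)) λ (q , q∈v , q∉u) →
           ¬P×Q (∉ᴷ-w⇒P p∈v p∉w) (∉ᴷ-u⇒Q q∈v q∉u)

module SuppressedTree {n} {𝒞 : CharSet n} {H : Graph (IVert 𝒞)} (CT : CliqueTree H) (φ : Fin n → Fin (t CT)) where

  private
    T = isTree CT

  degree-two⇒labelled : IsMinimalTriangulation (intGraph 𝒞) H → (∀ a → Candidate {n} {𝒞} CT a (φ a))
                      → ∀ v → degree (tadj CT) v ≡ 2 → ∃ λ a → φ a ≡ v
  degree-two⇒labelled minimal candidate v deg₂ with any? (λ a → φ a ≟ v)
  ... | yes labelled = labelled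
  ... | no ¬labelled with ∣tabulate∣≡2⇒pair (tadj CT v) deg₂
  ...   | u , w , u≢w , vu , vw , only =
    ⊥-elim (UnlabelledDegreeTwoNode.absurd {𝒞 = 𝒞} minimal CT candidate u≢w vu vw only (λ a φa≡v → ¬labelled (a , φa≡v)))

  labelled-degree-two⇒kept : (∀ v → degree (tadj CT) v ≡ 2 → ∃ λ a → φ a ≡ v) → ∀ v → Kept {n} {𝒞} CT φ v
  labelled-degree-two⇒kept labelled v with degree (tadj CT) v ≟ℕ 2
  ... | yes deg₂ = inj₁ (labelled v deg₂)
  ... | no  deg≢2 = inj₂ deg≢2

  all-kept⇒underlying-tree-is-T : (∀ v → Kept {n} {𝒞} CT φ v) → UnderlyingTreeIsT {n} {𝒞} CT φ
  all-kept⇒underlying-tree-is-T kept = kept , λ a b → mk⇔ to (from a b)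
    where
    to : ∀ {a b} → SuppAdj {n} {𝒞} CT φ a b → tadj CT a b ≡ true
    to (_ , _ , 0     , _ , _ , refl , refl , edges , _)        = edges zero
    to (_ , _ , suc _ , _ , _ , _    , _    , _     , interior) = ⊥-elim (interior zero (kept _))
    from : ∀ a b → tadj CT a b ≡ true → SuppAdj {n} {𝒞} CT φ a b
    from a b ab = kept a , kept b , 0 , p , p-injective , refl , refl , (λ { zero → ab }) , λ ()
      where
      p : Fin 2 → Fin (t CT)
      p zero    = a
      p (suc _) = b
      p-injective : Injective _≡_ _≡_ p
      p-injective {zero}     {zero}     _ = refl
      p-injective {zero}     {suc zero} e = ⊥-elim (Edge⇒≢ T ab e)
      p-injective {suc zero} {zero}     e = ⊥-elim (Edge⇒≢ T ab (sym e))
      p-injective {suc zero} {suc zero} _ = refl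

lemma7 : ∀ (n : ℕ) (𝒞 : CharSet n) (H : Graph (IVert 𝒞))
         → IsMinimalTriangulation (intGraph 𝒞) H
         → (CT : CliqueTree H) (φ : Fin n → Fin (t CT))
         → InducesXTree {n} {𝒞} {H} CT φ
         → UnderlyingTreeIsT {n} {𝒞} {H} CT φ
lemma7 n 𝒞 H minimal CT φ (candidate , _) =
  all-kept⇒underlying-tree-is-T (labelled-degree-two⇒kept (degree-two⇒labelled minimal candidate))
  where open SuppressedTree {n} {𝒞} {H} CT φ
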